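{- Let $G$ be a connected graph of diameter $2$ and let $x$ be a vertex of $G$. If $G-x$ also has diameter $2$, then ${\rm gp}(G)-1\le {\rm gp}(G-x)\le {\rm gp}(G)$. Moreover, both bounds are sharp: there exist such graphs $G$ and vertices $x$ with ${\rm gp}(G-x)={\rm gp}(G)-1$, and there exist such graphs $G$ and vertices $x$ with ${\rm gp}(G-x)={\rm gp}(G)$.
   Context: All graphs are simple. A set $X\subseteq V(G)$ is a general position set of $G$ if no three distinct vertices of $X$ lie on a common shortest path of $G$; ${\rm gp}(G)$ is the maximum cardinality of a general position set of $G$. $G-x$ is the subgraph induced by $V(G)\setminus\{x\}$. -}

module Defs where

open import Data.Nat using (ℕ; zero; suc; _≤_)
open import Data.Fin using (Fin; punchIn)
open import Data.Fin.Subset using (Subset; _∈_; ∣_∣)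
open import Data.Product using (Σ; ∃; _×_; _,_)
open import Relation.Binary.PropositionalEquality using (_≡_; _≢_)
open import Relation.Nullary using (¬_)
open import Level using (0ℓ) renaming (suc to lsuc)

record Graph (n : ℕ) : Set₁ where
  field
    Adj     : Fin n → Fin n → Set
    sym     : ∀ {u v} → Adj u v → Adj v u
    irrefl  : ∀ {u} → ¬ Adj u u
open Graph public

_-ᵥ_ : ∀ {n} → Graph (suc n) → Fin (suc n) → Graph n
G -ᵥ x = record
  { Adj    = λ i j → Adj G (punchIn x i) (punchIn x j)
  ; sym    = sym G
  ; irrefl = irrefl G
  }

data Walk {n : ℕ} (G : Graph n) : Fin n → Fin n → Set where
  [_]   : (u : Fin n) → Walk G u u
  _∷⟨_⟩_ : (u : Fin n) {v w : Fin n} → Adj G u v → Walk G v w → Walk G u w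

length : ∀ {n} {G : Graph n} {u v} → Walk G u v → ℕ
length [ _ ]          = 0
length (_ ∷⟨ _ ⟩ p)   = suc (length p)

data _∈W_ {n : ℕ} {G : Graph n} (z : Fin n) : ∀ {u v} → Walk G u v → Set where
  here-end : z ∈W [ z ]
  here     : ∀ {v w} (e : Adj G z v) (p : Walk G v w) → z ∈W (z ∷⟨ e ⟩ p)
  there    : ∀ {u v w} (e : Adj G u v) {p : Walk G v w} → z ∈W p → z ∈W (u ∷⟨ e ⟩ p)

IsGeodesic : ∀ {n} {G : Graph n} {u v} → Walk G u v → Set
IsGeodesic {G = G} {u} {v} p = ∀ (q : Walk G u v) → length p ≤ length q

Dist : ∀ {n} → Graph n → Fin n → Fin n → ℕ → Set
Dist G u v d = Σ (Walk G u v) λ p → IsGeodesic p × length p ≡ d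

HasDiameter : ∀ {n} → Graph n → ℕ → Set
HasDiameter {n} G D =
  (∀ (u v : Fin n) → ∃ λ d → Dist G u v d × d ≤ D)
  × (∃ λ u → ∃ λ v → Dist G u v D)

OnCommonGeodesic : ∀ {n} → Graph n → Fin n → Fin n → Fin n → Set
OnCommonGeodesic {n} G a b c =
  ∃ λ (u : Fin n) → ∃ λ (v : Fin n) → Σ (Walk G u v) λ p →
    IsGeodesic p × a ∈W p × b ∈W p × c ∈W p

IsGPSet : ∀ {n} → Graph n → Subset n → Set
IsGPSet G X = ∀ a b c → a ∈ X → b ∈ X → c ∈ X →
  a ≢ b → b ≢ c → a ≢ c → ¬ OnCommonGeodesic G a b c

IsGPNumber : ∀ {n} → Graph n → ℕ → Set
IsGPNumber {n} G k =
  (∃ λ (X : Subset n) → IsGPSet G X × ∣ X ∣ ≡ k)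
  × (∀ (X : Subset n) → IsGPSet G X → ∣ X ∣ ≤ k)

-- In a graph of diameter at most 2 every geodesic has at most three vertices, so three distinct
-- vertices lie on a common geodesic exactly when they induce a path P₃; general position sets are
-- thus the sets inducing no P₃.  That property only concerns the subgraph induced by the set, so a
-- general position set X of G gives X ∖ {x} in G - x, and a general position set of G - x is one
-- of G.  The bounds are attained by K₁,₃ minus a leaf (3 → 2) and C₄ minus a vertex (2 → 2),
-- which are checked by exhaustive search.
module Submission where

open import Defs
open import Data.Bool using (Bool; true; false)
import Data.Bool.Properties as Bool
open import Data.Empty using (⊥; ⊥-elim)
open import Data.Fin using (Fin; suc; punchIn; punchOut; _≟_)
open import Data.Fin.Patterns using (0F; 1F)
open import Data.Fin.Properties
  using (all?; any?; punchIn-injective; punchIn-punchOut; punchOut-punchIn; punchInᵢ≢i)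
open import Data.Fin.Subset using (Subset; _∈_; ∣_∣; inside; outside)
open import Data.Fin.Subset.Properties using (_∈?_; anySubset?)
open import Data.Nat using (ℕ; suc; _≤_; _<_; z≤n; s≤s)
open import Data.Nat.Properties using (≤-refl; ≤-reflexive; ≤-trans; m≤n⇒m≤1+n; ≮⇒≥; _<?_)
open import Data.Product using (∃; _×_; _,_; proj₁)
open import Data.Sum using (_⊎_; inj₁; inj₂)
open import Data.Vec using (Vec; []; _∷_; lookup; insertAt; removeAt)
open import Data.Vec.Properties
  using (insertAt-lookup; insertAt-punchIn; removeAt-punchOut; []=⇒lookup; lookup⇒[]=)
open import Function using (_∘_)
open import Relation.Binary.Definitions using (Decidable)
open import Relation.Binary.PropositionalEquality
  using (_≡_; _≢_; refl; cong; module ≡-Reasoning) renaming (sym to ≡-sym; trans to ≡-trans)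
open import Relation.Nullary using (¬_; Dec; ¬?; _×-dec_; _⊎-dec_; _→-dec_)
open import Relation.Nullary.Decidable as Dec using (from-yes)

private
  variable
    A : Set
    n D k k′ : ℕ
    G : Graph n
    X : Subset n
    a b c u v w z : Fin n

DiameterAtMost : Graph n → ℕ → Set
DiameterAtMost {n} G D = ∀ (u v : Fin n) → ∃ λ d → Dist G u v d × d ≤ D

edge : (G : Graph n) → Adj G u v → Walk G u v
edge _ e = _ ∷⟨ e ⟩ [ _ ]

path₂ : (G : Graph n) → Adj G u w → Adj G w v → Walk G u v
path₂ _ uw wv = _ ∷⟨ uw ⟩ (_ ∷⟨ wv ⟩ [ _ ])

record InducedP₃ (G : Graph n) (a b c : Fin n) : Set where
  constructor inducedP₃
  field
    adjˡ             : Adj G a b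
    adjʳ             : Adj G b c
    ends-distinct    : a ≢ c
    ends-nonadjacent : ¬ Adj G a c

  walk : Walk G a c
  walk = path₂ G adjˡ adjʳ

open InducedP₃ using (walk)

SpanInducedP₃ : Graph n → Fin n → Fin n → Fin n → Set
SpanInducedP₃ G a b c = InducedP₃ G b a c ⊎ InducedP₃ G a b c ⊎ InducedP₃ G a c b

InducesNoP₃ : Graph n → Subset n → Set
InducesNoP₃ G X = ∀ a b c → a ∈ X → b ∈ X → c ∈ X → ¬ InducedP₃ G a b c

adj⇒≢ : (G : Graph n) → Adj G u v → u ≢ v
adj⇒≢ G e refl = irrefl G e

inducedP₃-reverse : InducedP₃ G a b c → InducedP₃ G c b a
inducedP₃-reverse {G = G} (inducedP₃ ab bc a≢c ¬ac) =
  inducedP₃ (sym G bc) (sym G ab) (a≢c ∘ ≡-sym) (¬ac ∘ sym G)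

edge-isGeodesic : (e : Adj G u v) → IsGeodesic (edge G e)
edge-isGeodesic {G = G} e [ _ ] = ⊥-elim (irrefl G e)
edge-isGeodesic e (_ ∷⟨ _ ⟩ _) = s≤s z≤n

inducedP₃⇒isGeodesic : (P : InducedP₃ G u w v) → IsGeodesic (walk P)
inducedP₃⇒isGeodesic (inducedP₃ _ _ u≢v _) [ _ ]                     = ⊥-elim (u≢v refl)
inducedP₃⇒isGeodesic (inducedP₃ _ _ _ ¬uv) (_ ∷⟨ uv ⟩ [ _ ])         = ⊥-elim (¬uv uv)
inducedP₃⇒isGeodesic _                     (_ ∷⟨ _ ⟩ (_ ∷⟨ _ ⟩ _)) = s≤s (s≤s z≤n)

isGeodesic⇒inducedP₃ : (uw : Adj G u w) (wv : Adj G w v) →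
  IsGeodesic (path₂ G uw wv) → InducedP₃ G u w v
isGeodesic⇒inducedP₃ {G = G} {u} {w} {v} uw wv geo = inducedP₃ uw wv ends-distinct ends-nonadjacent
  where
  ends-distinct : u ≢ v
  ends-distinct refl with geo [ u ]
  ... | ()
  ends-nonadjacent : ¬ Adj G u v
  ends-nonadjacent uv with geo (u ∷⟨ uv ⟩ [ v ])
  ... | s≤s ()

inducedP₃⇒dist₂ : InducedP₃ G u w v → Dist G u v 2
inducedP₃⇒dist₂ P = walk P , inducedP₃⇒isGeodesic P , refl

inducedP₃⇒onCommonGeodesic : InducedP₃ G a b c → OnCommonGeodesic G a b c
inducedP₃⇒onCommonGeodesic P =
  _ , _ , walk P , inducedP₃⇒isGeodesic P , here _ _ , there _ (here _ _) , there _ (there _ here-end)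

geodesic-length≤ : DiameterAtMost G D → (p : Walk G u v) → IsGeodesic p → length p ≤ D
geodesic-length≤ diam p geo with diam _ _
... | _ , (q , _ , refl) , d≤D = ≤-trans (geo q) d≤D

∈-edge : {e : Adj G u v} → z ∈W edge G e → z ≡ u ⊎ z ≡ v
∈-edge (here _ _)         = inj₁ refl
∈-edge (there _ here-end) = inj₂ refl

∈-path₂ : {uw : Adj G u w} {wv : Adj G w v} →
  z ∈W path₂ G uw wv → z ≡ u ⊎ z ≡ w ⊎ z ≡ v
∈-path₂ (here _ _)  = inj₁ refl
∈-path₂ (there _ m) = inj₂ (∈-edge m)

no-three-distinct-in-pair : a ≡ u ⊎ a ≡ v → b ≡ u ⊎ b ≡ v → c ≡ u ⊎ c ≡ v →
  a ≢ b → b ≢ c → a ≢ c → ⊥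
no-three-distinct-in-pair (inj₁ refl) (inj₁ refl) _           a≢b _   _   = a≢b refl
no-three-distinct-in-pair (inj₂ refl) (inj₂ refl) _           a≢b _   _   = a≢b refl
no-three-distinct-in-pair (inj₁ refl) (inj₂ refl) (inj₁ refl) _   _   a≢c = a≢c refl
no-three-distinct-in-pair (inj₁ refl) (inj₂ refl) (inj₂ refl) _   b≢c _   = b≢c refl
no-three-distinct-in-pair (inj₂ refl) (inj₁ refl) (inj₁ refl) _   b≢c _   = b≢c refl
no-three-distinct-in-pair (inj₂ refl) (inj₁ refl) (inj₂ refl) _   _   a≢c = a≢c refl

private
  pattern is-u = inj₁ refl
  pattern is-w = inj₂ (inj₁ refl)
  pattern is-v = inj₂ (inj₂ refl)

three-distinct-on-inducedP₃ : InducedP₃ G u w v →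
  a ≡ u ⊎ a ≡ w ⊎ a ≡ v → b ≡ u ⊎ b ≡ w ⊎ b ≡ v → c ≡ u ⊎ c ≡ w ⊎ c ≡ v →
  a ≢ b → b ≢ c → a ≢ c → SpanInducedP₃ G a b c
three-distinct-on-inducedP₃ P is-u is-u _    a≢b _   _   = ⊥-elim (a≢b refl)
three-distinct-on-inducedP₃ P is-w is-w _    a≢b _   _   = ⊥-elim (a≢b refl)
three-distinct-on-inducedP₃ P is-v is-v _    a≢b _   _   = ⊥-elim (a≢b refl)
three-distinct-on-inducedP₃ P _    is-u is-u _   b≢c _   = ⊥-elim (b≢c refl)
three-distinct-on-inducedP₃ P _    is-w is-w _   b≢c _   = ⊥-elim (b≢c refl)
three-distinct-on-inducedP₃ P _    is-v is-v _   b≢c _   = ⊥-elim (b≢c refl)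
three-distinct-on-inducedP₃ P is-u _    is-u _   _   a≢c = ⊥-elim (a≢c refl)
three-distinct-on-inducedP₃ P is-w _    is-w _   _   a≢c = ⊥-elim (a≢c refl)
three-distinct-on-inducedP₃ P is-v _    is-v _   _   a≢c = ⊥-elim (a≢c refl)
three-distinct-on-inducedP₃ P is-w is-u is-v _   _   _   = inj₁ P
three-distinct-on-inducedP₃ P is-w is-v is-u _   _   _   = inj₁ (inducedP₃-reverse P)
three-distinct-on-inducedP₃ P is-u is-w is-v _   _   _   = inj₂ (inj₁ P)
three-distinct-on-inducedP₃ P is-v is-w is-u _   _   _   = inj₂ (inj₁ (inducedP₃-reverse P))
three-distinct-on-inducedP₃ P is-u is-v is-w _   _   _   = inj₂ (inj₂ P)
three-distinct-on-inducedP₃ P is-v is-u is-w _   _   _   = inj₂ (inj₂ (inducedP₃-reverse P))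

onCommonGeodesic⇒spanInducedP₃ : DiameterAtMost G 2 → a ≢ b → b ≢ c → a ≢ c →
  OnCommonGeodesic G a b c → SpanInducedP₃ G a b c
onCommonGeodesic⇒spanInducedP₃ {G = G} {a} {b} {c} diam a≢b b≢c a≢c (_ , _ , p , geo , a∈p , b∈p , c∈p) =
  onShortGeodesic p geo (geodesic-length≤ diam p geo) a∈p b∈p c∈p
  where
  onShortGeodesic : (p : Walk G u v) → IsGeodesic p → length p ≤ 2 →
    a ∈W p → b ∈W p → c ∈W p → SpanInducedP₃ G a b c
  onShortGeodesic [ _ ] _ _ here-end here-end _ = ⊥-elim (a≢b refl)
  onShortGeodesic (_ ∷⟨ _ ⟩ [ _ ]) _ _ a∈p b∈p c∈p =
    ⊥-elim (no-three-distinct-in-pair (∈-edge a∈p) (∈-edge b∈p) (∈-edge c∈p) a≢b b≢c a≢c)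
  onShortGeodesic (_ ∷⟨ uw ⟩ (_ ∷⟨ wv ⟩ [ _ ])) geo _ a∈p b∈p c∈p =
    three-distinct-on-inducedP₃ (isGeodesic⇒inducedP₃ uw wv geo)
      (∈-path₂ a∈p) (∈-path₂ b∈p) (∈-path₂ c∈p) a≢b b≢c a≢c
  onShortGeodesic (_ ∷⟨ _ ⟩ (_ ∷⟨ _ ⟩ (_ ∷⟨ _ ⟩ _))) _ (s≤s (s≤s ())) _ _ _

isGPSet⇒inducesNoP₃ : IsGPSet G X → InducesNoP₃ G X
isGPSet⇒inducesNoP₃ {G = G} gp a b c a∈X b∈X c∈X P@(inducedP₃ ab bc a≢c _) =
  gp a b c a∈X b∈X c∈X (adj⇒≢ G ab) (adj⇒≢ G bc) a≢c (inducedP₃⇒onCommonGeodesic P)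

inducesNoP₃⇒isGPSet : DiameterAtMost G 2 → InducesNoP₃ G X → IsGPSet G X
inducesNoP₃⇒isGPSet diam noP₃ a b c a∈X b∈X c∈X a≢b b≢c a≢c onGeodesic
  with onCommonGeodesic⇒spanInducedP₃ diam a≢b b≢c a≢c onGeodesic
... | inj₁ P        = noP₃ b a c b∈X a∈X c∈X P
... | inj₂ (inj₁ P) = noP₃ a b c a∈X b∈X c∈X P
... | inj₂ (inj₂ P) = noP₃ a c b a∈X c∈X b∈X P

inducedP₃-punchIn⁺ : (x : Fin (suc n)) → InducedP₃ (G -ᵥ x) a b c →
  InducedP₃ G (punchIn x a) (punchIn x b) (punchIn x c)
inducedP₃-punchIn⁺ x (inducedP₃ ab bc a≢c ¬ac) =
  inducedP₃ ab bc (a≢c ∘ punchIn-injective x _ _) ¬ac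

inducedP₃-punchIn⁻ : (x : Fin (suc n)) → InducedP₃ G (punchIn x a) (punchIn x b) (punchIn x c) →
  InducedP₃ (G -ᵥ x) a b c
inducedP₃-punchIn⁻ x (inducedP₃ ab bc a≢c ¬ac) = inducedP₃ ab bc (a≢c ∘ cong (punchIn x)) ¬ac

lookup-removeAt : (xs : Vec A (suc n)) (i : Fin (suc n)) (j : Fin n) →
  lookup (removeAt xs i) j ≡ lookup xs (punchIn i j)
lookup-removeAt xs i j = begin
  lookup (removeAt xs i) j                                   ≡⟨ cong (lookup (removeAt xs i)) (punchOut-punchIn i) ⟨
  lookup (removeAt xs i) (punchOut (punchInᵢ≢i i j ∘ ≡-sym)) ≡⟨ removeAt-punchOut xs _ ⟩
  lookup xs (punchIn i j)                                    ∎
  where open ≡-Reasoning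

∈-removeAt⁻ : (p : Subset (suc n)) (i : Fin (suc n)) → a ∈ removeAt p i → punchIn i a ∈ p
∈-removeAt⁻ p i a∈ = lookup⇒[]= _ p (≡-trans (≡-sym (lookup-removeAt p i _)) ([]=⇒lookup a∈))

∈-insertAt-outside⁻ : (p : Subset n) (i : Fin (suc n)) →
  a ∈ insertAt p i outside → ∃ λ a′ → punchIn i a′ ≡ a × a′ ∈ p
∈-insertAt-outside⁻ {a = a} p i a∈ = punchOut i≢a , punchIn-punchOut i≢a , lookup⇒[]= _ p (begin
  lookup p (punchOut i≢a)                                     ≡⟨ insertAt-punchIn p i outside _ ⟨
  lookup (insertAt p i outside) (punchIn i (punchOut i≢a))    ≡⟨ cong (lookup (insertAt p i outside)) (punchIn-punchOut i≢a) ⟩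
  lookup (insertAt p i outside) a                             ≡⟨ []=⇒lookup a∈ ⟩
  inside                                                      ∎)
  where
  open ≡-Reasoning
  i≢a : i ≢ a
  i≢a refl with ≡-trans (≡-sym (insertAt-lookup p i outside)) ([]=⇒lookup a∈)
  ... | ()

∣insertAt-outside∣ : (p : Subset n) (i : Fin (suc n)) → ∣ insertAt p i outside ∣ ≡ ∣ p ∣
∣insertAt-outside∣ p             0F      = refl
∣insertAt-outside∣ (inside ∷ p)  (suc i) = cong suc (∣insertAt-outside∣ p i)
∣insertAt-outside∣ (outside ∷ p) (suc i) = ∣insertAt-outside∣ p i

∣p∣≤1+∣removeAt∣ : (p : Subset (suc n)) (i : Fin (suc n)) → ∣ p ∣ ≤ suc ∣ removeAt p i ∣
∣p∣≤1+∣removeAt∣ (inside ∷ p)      0F      = ≤-refl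
∣p∣≤1+∣removeAt∣ (outside ∷ p)     0F      = m≤n⇒m≤1+n ≤-refl
∣p∣≤1+∣removeAt∣ (inside ∷ q ∷ p)  (suc i) = s≤s (∣p∣≤1+∣removeAt∣ (q ∷ p) i)
∣p∣≤1+∣removeAt∣ (outside ∷ q ∷ p) (suc i) = ∣p∣≤1+∣removeAt∣ (q ∷ p) i

removeAt-inducesNoP₃ : (x : Fin (suc n)) → InducesNoP₃ G X → InducesNoP₃ (G -ᵥ x) (removeAt X x)
removeAt-inducesNoP₃ {X = X} x noP₃ a b c a∈ b∈ c∈ P =
  noP₃ _ _ _ (∈-removeAt⁻ X x a∈) (∈-removeAt⁻ X x b∈) (∈-removeAt⁻ X x c∈) (inducedP₃-punchIn⁺ x P)

insertAt-inducesNoP₃ : (x : Fin (suc n)) → InducesNoP₃ (G -ᵥ x) X → InducesNoP₃ G (insertAt X x outside)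
insertAt-inducesNoP₃ {X = X} x noP₃ a b c a∈ b∈ c∈ P
  with ∈-insertAt-outside⁻ X x a∈ | ∈-insertAt-outside⁻ X x b∈ | ∈-insertAt-outside⁻ X x c∈
... | a′ , refl , a′∈ | b′ , refl , b′∈ | c′ , refl , c′∈ =
  noP₃ a′ b′ c′ a′∈ b′∈ c′∈ (inducedP₃-punchIn⁻ x P)

gp≤1+gp-ᵥ : (x : Fin (suc n)) → DiameterAtMost (G -ᵥ x) 2 →
  IsGPNumber G k → IsGPNumber (G -ᵥ x) k′ → k ≤ suc k′
gp≤1+gp-ᵥ x diam ((X , gpX , refl) , _) (_ , maximal) =
  ≤-trans (∣p∣≤1+∣removeAt∣ X x)
    (s≤s (maximal _ (inducesNoP₃⇒isGPSet diam (removeAt-inducesNoP₃ x (isGPSet⇒inducesNoP₃ gpX)))))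

gp-ᵥ≤gp : (x : Fin (suc n)) → DiameterAtMost G 2 →
  IsGPNumber G k → IsGPNumber (G -ᵥ x) k′ → k′ ≤ k
gp-ᵥ≤gp x diam (_ , maximal) ((X , gpX , refl) , _) =
  ≤-trans (≤-reflexive (≡-sym (∣insertAt-outside∣ X x)))
    (maximal _ (inducesNoP₃⇒isGPSet diam (insertAt-inducesNoP₃ x (isGPSet⇒inducesNoP₃ gpX))))

-- The last case asks for an induced P₃ rather than a mere common neighbour,
-- so that it certifies distance exactly 2.
WithinTwo : Graph n → Fin n → Fin n → Set
WithinTwo G u v = u ≡ v ⊎ Adj G u v ⊎ ∃ λ w → InducedP₃ G u w v

withinTwo⇒dist≤2 : WithinTwo G u v → ∃ λ d → Dist G u v d × d ≤ 2
withinTwo⇒dist≤2 (inj₁ refl)            = 0 , ([ _ ] , (λ _ → z≤n) , refl) , z≤n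
withinTwo⇒dist≤2 (inj₂ (inj₁ uv))       = 1 , (edge _ uv , edge-isGeodesic uv , refl) , s≤s z≤n
withinTwo⇒dist≤2 (inj₂ (inj₂ (_ , P)))  = 2 , inducedP₃⇒dist₂ P , ≤-refl

hasDiameter2 : (∀ u v → WithinTwo G u v) × (∃ λ a → ∃ λ b → ∃ λ c → InducedP₃ G a b c) →
  HasDiameter G 2
hasDiameter2 (withinTwo , _ , _ , _ , P) =
  (λ u v → withinTwo⇒dist≤2 (withinTwo u v)) , _ , _ , inducedP₃⇒dist₂ P

IsMaximumP₃FreeSet : Graph n → Subset n → Set
IsMaximumP₃FreeSet {n} G X = InducesNoP₃ G X × ¬ (∃ λ (Y : Subset n) → InducesNoP₃ G Y × ∣ X ∣ < ∣ Y ∣)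

maximumP₃FreeSet⇒isGPNumber : DiameterAtMost G 2 → IsMaximumP₃FreeSet G X → IsGPNumber G ∣ X ∣
maximumP₃FreeSet⇒isGPNumber {X = X} diam (noP₃ , noLarger) =
  (X , inducesNoP₃⇒isGPSet diam noP₃ , refl) ,
  λ Y gpY → ≮⇒≥ (λ ∣X∣<∣Y∣ → noLarger (Y , isGPSet⇒inducesNoP₃ gpY , ∣X∣<∣Y∣))

module Decide (G : Graph n) (adj? : Decidable (Adj G)) where

  inducedP₃? : ∀ a b c → Dec (InducedP₃ G a b c)
  inducedP₃? a b c = Dec.map′ (λ (ab , bc , a≢c , ¬ac) → inducedP₃ ab bc a≢c ¬ac)
    (λ (inducedP₃ ab bc a≢c ¬ac) → ab , bc , a≢c , ¬ac)
    (adj? a b ×-dec adj? b c ×-dec ¬? (a ≟ c) ×-dec ¬? (adj? a c))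

  hasDiameter2? : Dec ((∀ u v → WithinTwo G u v) × (∃ λ a → ∃ λ b → ∃ λ c → InducedP₃ G a b c))
  hasDiameter2? = (all? λ u → all? λ v → u ≟ v ⊎-dec adj? u v ⊎-dec any? λ w → inducedP₃? u w v)
    ×-dec (any? λ a → any? λ b → any? λ c → inducedP₃? a b c)

  inducesNoP₃? : ∀ X → Dec (InducesNoP₃ G X)
  inducesNoP₃? X = all? λ a → all? λ b → all? λ c →
    a ∈? X →-dec b ∈? X →-dec c ∈? X →-dec ¬? (inducedP₃? a b c)

  isMaximumP₃FreeSet? : ∀ X → Dec (IsMaximumP₃FreeSet G X)
  isMaximumP₃FreeSet? X = inducesNoP₃? X ×-dec ¬? (anySubset? λ Y → inducesNoP₃? Y ×-dec ∣ X ∣ <? ∣ Y ∣)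

-ᵥ-adj? : (G : Graph (suc n)) → Decidable (Adj G) → (x : Fin (suc n)) → Decidable (Adj (G -ᵥ x))
-ᵥ-adj? _ adj? x u v = adj? (punchIn x u) (punchIn x v)

completeBipartite : (Fin n → Bool) → Graph n
completeBipartite side = record
  { Adj    = λ u v → side u ≢ side v
  ; sym    = _∘ ≡-sym
  ; irrefl = λ side-u≢side-u → side-u≢side-u refl
  }

completeBipartite-adj? : (side : Fin n → Bool) → Decidable (Adj (completeBipartite side))
completeBipartite-adj? side u v = ¬? (side u Bool.≟ side v)

K₁,₃ : Graph 4
K₁,₃ = completeBipartite (lookup (true ∷ false ∷ false ∷ false ∷ []))

-- The cycle 0 – 1 – 2 – 3 – 0 as K₂,₂ with parts {0, 2} and {1, 3}.
C₄ : Graph 4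
C₄ = completeBipartite (lookup (true ∷ false ∷ true ∷ false ∷ []))

module K₁,₃ = Decide K₁,₃ (completeBipartite-adj? _)
module K₁,₃-minus-leaf = Decide (K₁,₃ -ᵥ 1F) (-ᵥ-adj? K₁,₃ (completeBipartite-adj? _) 1F)
module C₄ = Decide C₄ (completeBipartite-adj? _)
module C₄-minus-vertex = Decide (C₄ -ᵥ 0F) (-ᵥ-adj? C₄ (completeBipartite-adj? _) 0F)

K₁,₃-diameter : HasDiameter K₁,₃ 2
K₁,₃-diameter = hasDiameter2 (from-yes K₁,₃.hasDiameter2?)

K₁,₃-minus-leaf-diameter : HasDiameter (K₁,₃ -ᵥ 1F) 2
K₁,₃-minus-leaf-diameter = hasDiameter2 (from-yes K₁,₃-minus-leaf.hasDiameter2?)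

K₁,₃-gp : IsGPNumber K₁,₃ 3
K₁,₃-gp = maximumP₃FreeSet⇒isGPNumber (proj₁ K₁,₃-diameter)
  (from-yes (K₁,₃.isMaximumP₃FreeSet? (false ∷ true ∷ true ∷ true ∷ [])))

K₁,₃-minus-leaf-gp : IsGPNumber (K₁,₃ -ᵥ 1F) 2
K₁,₃-minus-leaf-gp = maximumP₃FreeSet⇒isGPNumber (proj₁ K₁,₃-minus-leaf-diameter)
  (from-yes (K₁,₃-minus-leaf.isMaximumP₃FreeSet? (false ∷ true ∷ true ∷ [])))

C₄-diameter : HasDiameter C₄ 2
C₄-diameter = hasDiameter2 (from-yes C₄.hasDiameter2?)

C₄-minus-vertex-diameter : HasDiameter (C₄ -ᵥ 0F) 2
C₄-minus-vertex-diameter = hasDiameter2 (from-yes C₄-minus-vertex.hasDiameter2?)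

C₄-gp : IsGPNumber C₄ 2
C₄-gp = maximumP₃FreeSet⇒isGPNumber (proj₁ C₄-diameter)
  (from-yes (C₄.isMaximumP₃FreeSet? (true ∷ false ∷ true ∷ false ∷ [])))

C₄-minus-vertex-gp : IsGPNumber (C₄ -ᵥ 0F) 2
C₄-minus-vertex-gp = maximumP₃FreeSet⇒isGPNumber (proj₁ C₄-minus-vertex-diameter)
  (from-yes (C₄-minus-vertex.isMaximumP₃FreeSet? (true ∷ false ∷ true ∷ [])))

theorem5p2 :
    (∀ (n : ℕ) (G : Graph (suc n)) (x : Fin (suc n)) →
      HasDiameter G 2 → HasDiameter (G -ᵥ x) 2 →
      ∀ (k k′ : ℕ) → IsGPNumber G k → IsGPNumber (G -ᵥ x) k′ →
      (k ≤ suc k′) × (k′ ≤ k))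
    × (∃ λ (n : ℕ) → ∃ λ (G : Graph (suc n)) → ∃ λ (x : Fin (suc n)) →
        HasDiameter G 2 × HasDiameter (G -ᵥ x) 2 ×
        ∃ λ (k : ℕ) → ∃ λ (k′ : ℕ) →
          IsGPNumber G k × IsGPNumber (G -ᵥ x) k′ × suc k′ ≡ k)
    × (∃ λ (n : ℕ) → ∃ λ (G : Graph (suc n)) → ∃ λ (x : Fin (suc n)) →
        HasDiameter G 2 × HasDiameter (G -ᵥ x) 2 ×
        ∃ λ (k : ℕ) →
          IsGPNumber G k × IsGPNumber (G -ᵥ x) k)
theorem5p2 =
  (λ _ _ x (diamG , _) (diamG-x , _) _ _ gpG gpG-x →
    gp≤1+gp-ᵥ x diamG-x gpG gpG-x , gp-ᵥ≤gp x diamG gpG gpG-x) ,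
  (3 , K₁,₃ , 1F , K₁,₃-diameter , K₁,₃-minus-leaf-diameter , 3 , 2 , K₁,₃-gp , K₁,₃-minus-leaf-gp , refl) ,
  (3 , C₄ , 0F , C₄-diameter , C₄-minus-vertex-diameter , 2 , C₄-gp , C₄-minus-vertex-gp)
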